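{- Let $G=(V,E,\ell)$ be a labeled DAG and $Q\in\Sigma^+$ a query string, let $A$ be the set of all node MEMs between $Q$ and $G$, and let $M$ be the set of all MEMs between $Q$ and $G$. Then $|A|\le\lVert M\rVert$, where $\lVert M\rVert$ is the total length of the encoding of the paths of the MEMs in $M$ as explicit sequences of nodes (i.e. the sum, over all $([x..y],(i,P,j))\in M$, of the number of nodes of $P$).
   Context: Strings are over a finite alphabet $\Sigma$. A labeled DAG is $G=(V,E,\ell)$ with $\ell:V\to\Sigma^+$; $\lVert v\rVert=|\ell(v)|$. A substring of $G$ is a triple $(i,P,j)$ with $P=v_1\ldots v_k$ a path, $1\le i\le\lVert v_1\rVert$, $1\le j\le\lVert v_k\rVert$, spelling $\ell(v_1)[i..]\cdot\ell(v_2)\cdots\ell(v_{k-1})\cdot\ell(v_k)[..j]$ (for $k=1$, $\ell(v_1)[i..j]$). A match between $Q$ and $G$ is a pair $([x..y],(i,P,j))$ with $Q[x..y]$ equal to the string spelled by $(i,P,j)$. The left-extension $\mathrm{leftext}(i,P,j)$ is $\{\ell(v_1)[i-1]\}$ if $i>1$ and $\{\ell(u)[\lVert u\rVert]:(u,v_1)\in E\}$ otherwise; the right-extension $\mathrm{rightext}(i,P,j)$ is $\{\ell(v_k)[j+1]\}$ if $j<\lVert v_k\rVert$ and $\{\ell(w)[1]:(v_k,w)\in E\}$ otherwise. LeftMax: $x=1$ or $\mathrm{leftext}=\emptyset$ or $Q[x-1]\notin\mathrm{leftext}(i,P,j)$; RightMax: $y=|Q|$ or $\mathrm{rightext}=\emptyset$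 or $Q[y+1]\notin\mathrm{rightext}(i,P,j)$. A match is a MEM between $Q$ and $G$ if (LeftMax or $|\mathrm{leftext}(i,P,j)|\ge2$) and (RightMax or $|\mathrm{rightext}(i,P,j)|\ge2$). A node MEM is a match $([x..y],(i,v,j))$ whose path is a single node $v$ and which satisfies (LeftMax or $i=1$) and (RightMax or $j=\lVert v\rVert$). -}

module Defs where

open import Data.Nat using (ℕ; zero; suc; _≤_; _<_; _∸_; _+_)
open import Data.Fin using (Fin)
open import Data.List as L using (List; []; _∷_; _++_; take; drop; length)
open import Data.List.NonEmpty as L⁺ using (List⁺; _∷_; toList; head; last)
open import Data.List.Membership.Propositional using (_∈_)
open import Data.List.Relation.Unary.Unique.Propositional using (Unique)
open import Data.Maybe using (Maybe; just; nothing)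
open import Data.Product using (Σ; ∃; ∃-syntax; _×_; _,_)
open import Data.Sum using (_⊎_)
open import Relation.Nullary using (¬_)
open import Relation.Binary.PropositionalEquality using (_≡_; _≢_)
open import Function.Bundles using (_⇔_)

-- 1-based character access: at s k = just s[k] for 1 ≤ k ≤ |s|, nothing otherwise.
at : {A : Set} → List A → ℕ → Maybe A
at []       _             = nothing
at (a ∷ s)  zero          = nothing
at (a ∷ s)  (suc zero)    = just a
at (a ∷ s)  (suc (suc k)) = at s (suc k)

-- 1-based substring s[x..y]
substr : {A : Set} → List A → ℕ → ℕ → List A
substr s x y = drop (x ∸ 1) (take y s)

record LabeledGraph (σ : ℕ) : Set where
  field
    n     : ℕ
    E     : List (Fin n × Fin n)
    label : Fin n → List⁺ (Fin σ)

module _ {σ : ℕ} (G : LabeledGraph σ) where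
  open LabeledGraph G

  Edge : Fin n → Fin n → Set
  Edge u v = (u , v) ∈ E

  ℓ : Fin n → List (Fin σ)
  ℓ v = toList (label v)

  ∥_∥ : Fin n → ℕ
  ∥ v ∥ = length (ℓ v)

  IsPathL : Fin n → List (Fin n) → Set
  IsPathL v []       = Data.Unit.⊤ where import Data.Unit
  IsPathL v (w ∷ ws) = Edge v w × IsPathL w ws

  IsPath : List⁺ (Fin n) → Set
  IsPath (v ∷ vs) = IsPathL v vs

  IsDAG : Set
  IsDAG = ∀ (P : List⁺ (Fin n)) → IsPath P → 2 ≤ L⁺.length P → head P ≢ last P

  spellTail : Fin n → List (Fin n) → ℕ → List (Fin σ)
  spellTail v []       j = take j (ℓ v)
  spellTail v (w ∷ ws) j = ℓ v ++ spellTail w ws j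

  spell : ℕ → List⁺ (Fin n) → ℕ → List (Fin σ)
  spell i (v ∷ [])     j = substr (ℓ v) i j
  spell i (v ∷ w ∷ ws) j = drop (i ∸ 1) (ℓ v) ++ spellTail w ws j

  record Match : Set where
    constructor mkMatch
    field
      x y i : ℕ
      path  : List⁺ (Fin n)
      j     : ℕ

  open Match public

  pathLength : Match → ℕ
  pathLength m = L⁺.length (path m)

  module _ (Q : List⁺ (Fin σ)) where
    Qs : List (Fin σ)
    Qs = toList Q

    IsMatch : Match → Set
    IsMatch m =
      (1 ≤ x m × x m ≤ y m × y m ≤ length Qs)
      × IsPath (path m)
      × (1 ≤ i m × i m ≤ ∥ head (path m) ∥)
      × (1 ≤ j m × j m ≤ ∥ last (path m) ∥)
      × substr Qs (x m) (y m) ≡ spell (i m) (path m) (j m)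

    InLeftExt : Match → Fin σ → Set
    InLeftExt m c =
      (1 < i m × at (ℓ (head (path m))) (i m ∸ 1) ≡ just c)
      ⊎ (i m ≡ 1 × ∃[ u ] (Edge u (head (path m)) × L⁺.last (label u) ≡ c))

    InRightExt : Match → Fin σ → Set
    InRightExt m c =
      (j m < ∥ last (path m) ∥ × at (ℓ (last (path m))) (j m + 1) ≡ just c)
      ⊎ (j m ≡ ∥ last (path m) ∥ × ∃[ w ] (Edge (last (path m)) w × L⁺.head (label w) ≡ c))

    LeftMax : Match → Set
    LeftMax m =
      x m ≡ 1
      ⊎ (∀ c → ¬ InLeftExt m c)
      ⊎ (∃[ c ] (at Qs (x m ∸ 1) ≡ just c × ¬ InLeftExt m c))

    RightMax : Match → Set
    RightMax m =
      y m ≡ length Qs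
      ⊎ (∀ c → ¬ InRightExt m c)
      ⊎ (∃[ c ] (at Qs (y m + 1) ≡ just c × ¬ InRightExt m c))

    LeftBranch : Match → Set
    LeftBranch m = ∃[ c ] ∃[ d ] (c ≢ d × InLeftExt m c × InLeftExt m d)

    RightBranch : Match → Set
    RightBranch m = ∃[ c ] ∃[ d ] (c ≢ d × InRightExt m c × InRightExt m d)

    IsMEM : Match → Set
    IsMEM m = IsMatch m × (LeftMax m ⊎ LeftBranch m) × (RightMax m ⊎ RightBranch m)

    IsNodeMEM : Match → Set
    IsNodeMEM m =
      IsMatch m × L⁺.tail (path m) ≡ []
      × (LeftMax m ⊎ i m ≡ 1)
      × (RightMax m ⊎ j m ≡ ∥ head (path m) ∥)

Enumerates : {A : Set} → (A → Set) → List A → Set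
Enumerates P xs = Unique xs × (∀ a → (a ∈ xs) ⇔ P a)

-- A node MEM is the restriction to a single node of some MEM. Extend it greedily, first to the
-- right and then to the left, one query character at a time, as long as that character lies in
-- the extension set; every step consumes a character of Q, so this ends in a match that is both
-- RightMax and LeftMax, i.e. a MEM. Splitting a match into its restrictions to the nodes of its
-- path gives as many pieces as the path has nodes, and the extension keeps the node MEM among the
-- pieces: a step changes only the piece at the end where it acts, and a node MEM sitting there is
-- either maximal on that side already or ends at the node boundary, so the step enters a new node.
-- Hence the distinct node MEMs occur among the pieces of the MEMs, and |A| ≤ ‖M‖.
module Submission where

open import Defs
open import Data.Nat using (ℕ; zero; suc; _≤_; _<_; _∸_; _+_; z≤n; s≤s; _<?_)
open import Data.Nat.Properties
  using (≤-refl; ≤-trans; ≤-antisym; <⇒≤; <⇒≢; <-irrefl; n≤1+n; m≤n⇒m≤1+n; m≤n+m; m∸n≤m;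
         m≤n⇒m⊓n≡m; m≤n⇒m<n∨m≡n; m<n⇒0<n∸m; m∸n≢0⇒n<m; m+[n∸m]≡n; +-∸-assoc; n∸n≡0;
         +-suc; +-comm; +-identityʳ; module ≤-Reasoning)
import Data.Nat.Properties as ℕ
open import Data.Fin using (Fin)
import Data.Fin.Properties as Fin
open import Data.List using (List; []; _∷_; _++_; _∷ʳ_; take; drop; length; map; concatMap; initLast; _∷ʳ′_)
open import Data.List.Properties using (length-++; ++-assoc; length-take; length-drop; take-all)
open import Data.List.NonEmpty using (List⁺; _∷_; _∷⁺_; _⁺∷ʳ_; toList; head; tail; last)
open import Data.List.Membership.Propositional using (_∈_)
open import Data.List.Membership.Propositional.Properties
  using (∈-∃++; ∈-++⁻; ∈-++⁺ˡ; ∈-++⁺ʳ; ∈-concat⁺′; ∈-map⁺)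
import Data.List.Membership.DecPropositional as DecMembership
open import Data.List.Relation.Unary.All using () renaming (lookup to All-lookup)
open import Data.List.Relation.Unary.AllPairs using (_∷_)
open import Data.List.Relation.Unary.Any using (here; there)
open import Data.List.Relation.Unary.Unique.Propositional using (Unique)
open import Data.Maybe using (just)
import Data.Maybe.Properties as Maybe
open import Data.Maybe.Properties using (just-injective)
open import Data.Nat.ListAction using (sum)
open import Data.Product using (∃-syntax; _×_; _,_)
import Data.Product.Properties as Product
open import Data.Sum using (_⊎_; inj₁; inj₂; [_,_]′)
open import Data.Empty using (⊥-elim)
open import Data.Unit using (tt)
open import Function.Bundles using (Equivalence)
open import Function using (_∘_)
open import Relation.Nullary using (¬_; Dec; yes; no)
open import Relation.Nullary.Decidable using (_×-dec_; _⊎-dec_)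
open import Relation.Binary.PropositionalEquality
  using (_≡_; refl; sym; trans; cong; cong₂; subst; ≢-sym; module ≡-Reasoning)

module _ {A : Set} where

  last-∷ : (a b : A) (bs : List A) → last (a ∷ b ∷ bs) ≡ last (b ∷ bs)
  last-∷ a b bs with initLast bs
  ... | []       = refl
  ... | _ ∷ʳ′ _  = refl

  last-∷ʳ : (v : A) (ws : List A) (w : A) → last (v ∷ (ws ∷ʳ w)) ≡ w
  last-∷ʳ v []       w = refl
  last-∷ʳ v (u ∷ ws) w = trans (last-∷ v u (ws ∷ʳ w)) (last-∷ʳ u ws w)

  drop-length-last : (a : A) (as : List A) → drop (length as) (a ∷ as) ≡ last (a ∷ as) ∷ []
  drop-length-last a []       = refl
  drop-length-last a (b ∷ bs) = trans (drop-length-last b bs) (cong (_∷ []) (sym (last-∷ a b bs)))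

  at-< : ∀ {k} (s : List A) → k < length s → ∃[ c ] at s (suc k) ≡ just c
  at-< {zero}  (a ∷ s) _         = a , refl
  at-< {suc k} (a ∷ s) (s≤s k<s) = at-< s k<s

  at-+1 : (s : List A) (k : ℕ) → at s (k + 1) ≡ at s (suc k)
  at-+1 s k = cong (at s) (+-comm k 1)

  drop-take-suc : ∀ {k b c} (s : List A) → at s (suc b) ≡ just c → k ≤ b
                → drop k (take (suc b) s) ≡ drop k (take b s) ++ c ∷ []
  drop-take-suc {zero}  {zero}  (a ∷ s) refl _         = refl
  drop-take-suc {zero}  {suc b} (a ∷ s) eq   _         = cong (a ∷_) (drop-take-suc s eq z≤n)
  drop-take-suc {suc k} {suc b} (a ∷ s) eq   (s≤s k≤b) = drop-take-suc s eq k≤b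

  drop-take-cons : ∀ {k b c} (s : List A) → at s (suc k) ≡ just c → k < b
                 → drop k (take b s) ≡ c ∷ drop (suc k) (take b s)
  drop-take-cons {zero}  {suc b} (a ∷ s) refl _         = refl
  drop-take-cons {suc k} {suc b} (a ∷ s) eq   (s≤s k<b) = drop-take-cons s eq k<b

  drop-cons : ∀ {k c} (s : List A) → at s (suc k) ≡ just c → drop k s ≡ c ∷ drop (suc k) s
  drop-cons {zero}  (a ∷ s) refl = refl
  drop-cons {suc k} (a ∷ s) eq   = drop-cons s eq

  length-drop-take : ∀ k {b} (s : List A) → b ≤ length s → length (drop k (take b s)) ≡ b ∸ k
  length-drop-take k {b} s b≤s =
    trans (length-drop k (take b s)) (cong (_∸ k) (trans (length-take b s) (m≤n⇒m⊓n≡m b≤s)))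

  Unique-⊆⇒length≤ : ∀ {xs ys : List A} → Unique xs → (∀ {a} → a ∈ xs → a ∈ ys)
                   → length xs ≤ length ys
  Unique-⊆⇒length≤ {[]}     _              _     = z≤n
  Unique-⊆⇒length≤ {a ∷ xs} (a∉xs ∷ uniq) xs⊆ys with ∈-∃++ (xs⊆ys (here refl))
  ... | ys₁ , ys₂ , refl = begin
      suc (length xs)             ≤⟨ s≤s (Unique-⊆⇒length≤ uniq xs⊆ys₁ys₂) ⟩
      suc (length (ys₁ ++ ys₂))   ≡⟨ cong suc (length-++ ys₁) ⟩
      suc (length ys₁ + length ys₂) ≡⟨ sym (+-suc (length ys₁) (length ys₂)) ⟩
      length ys₁ + length (a ∷ ys₂) ≡⟨ sym (length-++ ys₁) ⟩
      length (ys₁ ++ a ∷ ys₂)     ∎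
    where
    open ≤-Reasoning
    xs⊆ys₁ys₂ : ∀ {b} → b ∈ xs → b ∈ ys₁ ++ ys₂
    xs⊆ys₁ys₂ b∈xs with ∈-++⁻ ys₁ (xs⊆ys (there b∈xs))
    ... | inj₁ b∈ys₁         = ∈-++⁺ˡ b∈ys₁
    ... | inj₂ (here b≡a)    = ⊥-elim (All-lookup a∉xs b∈xs (sym b≡a))
    ... | inj₂ (there b∈ys₂) = ∈-++⁺ʳ ys₁ b∈ys₂

∸-suc : ∀ {m n} → m < n → n ∸ m ≡ suc (n ∸ suc m)
∸-suc {n = suc n} (s≤s m≤n) = +-∸-assoc 1 m≤n

module _ {σ : ℕ} (G : LabeledGraph σ) where
  open LabeledGraph G
  open ≡-Reasoning

  ‖_‖ : Fin n → ℕ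
  ‖_‖ = ∥_∥ G

  IsPathL-∷ʳ : ∀ v ws {w} → IsPathL G v ws → Edge G (last (v ∷ ws)) w → IsPathL G v (ws ∷ʳ w)
  IsPathL-∷ʳ v []       _          e = e , tt
  IsPathL-∷ʳ v (u ∷ ws) (e₀ , path) e =
    e₀ , IsPathL-∷ʳ u ws path (subst (λ z → Edge G z _) (last-∷ v u ws) e)

  spellTail-suc : ∀ v ws {j c} → at (ℓ G (last (v ∷ ws))) (suc j) ≡ just c
                → spellTail G v ws (suc j) ≡ spellTail G v ws j ++ c ∷ []
  spellTail-suc v []       eq = drop-take-suc (ℓ G v) eq z≤n
  spellTail-suc v (w ∷ ws) {j} {c} eq = begin
    ℓ G v ++ spellTail G w ws (suc j)       ≡⟨ cong (ℓ G v ++_) (spellTail-suc w ws eq′) ⟩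
    ℓ G v ++ (spellTail G w ws j ++ c ∷ []) ≡⟨ sym (++-assoc (ℓ G v) _ _) ⟩
    (ℓ G v ++ spellTail G w ws j) ++ c ∷ [] ∎
    where eq′ = subst (λ z → at (ℓ G z) (suc j) ≡ just c) (last-∷ v w ws) eq

  -- On a single node spell is the substring ℓ(v)[i..j], which extends by a character at either end
  -- only when it is nonempty; hence the side conditions here and in spell-cons.
  spell-suc : ∀ {i} v ws {j c} → (ws ≡ [] → i ∸ 1 < j) → at (ℓ G (last (v ∷ ws))) (suc j) ≡ just c
            → spell G i (v ∷ ws) (suc j) ≡ spell G i (v ∷ ws) j ++ c ∷ []
  spell-suc         v []       i≤j eq = drop-take-suc (ℓ G v) eq (<⇒≤ (i≤j refl))
  spell-suc {i} v (w ∷ ws) {j} {c} _ eq = begin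
    drop (i ∸ 1) (ℓ G v) ++ spellTail G w ws (suc j)
      ≡⟨ cong (drop (i ∸ 1) (ℓ G v) ++_) (spellTail-suc w ws eq′) ⟩
    drop (i ∸ 1) (ℓ G v) ++ (spellTail G w ws j ++ c ∷ [])
      ≡⟨ sym (++-assoc (drop (i ∸ 1) (ℓ G v)) _ _) ⟩
    (drop (i ∸ 1) (ℓ G v) ++ spellTail G w ws j) ++ c ∷ [] ∎
    where eq′ = subst (λ z → at (ℓ G z) (suc j) ≡ just c) (last-∷ v w ws) eq

  spellTail-∷ʳ : ∀ v ws {j} w → j ≡ ‖ last (v ∷ ws) ‖
               → spellTail G v (ws ∷ʳ w) 1 ≡ spellTail G v ws j ++ head (label w) ∷ []
  spellTail-∷ʳ v []       w refl = cong (_++ head (label w) ∷ []) (sym (take-all ‖ v ‖ (ℓ G v) ≤-refl))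
  spellTail-∷ʳ v (u ∷ ws) w j≡ = begin
    ℓ G v ++ spellTail G u (ws ∷ʳ w) 1                   ≡⟨ cong (ℓ G v ++_) (spellTail-∷ʳ u ws w j≡′) ⟩
    ℓ G v ++ (spellTail G u ws _ ++ head (label w) ∷ []) ≡⟨ sym (++-assoc (ℓ G v) _ _) ⟩
    (ℓ G v ++ spellTail G u ws _) ++ head (label w) ∷ [] ∎
    where j≡′ = trans j≡ (cong ‖_‖ (last-∷ v u ws))

  spell-∷ʳ : ∀ i v ws {j} w → j ≡ ‖ last (v ∷ ws) ‖
           → spell G i (v ∷ (ws ∷ʳ w)) 1 ≡ spell G i (v ∷ ws) j ++ head (label w) ∷ []
  spell-∷ʳ i v []       w refl =
    cong (λ s → drop (i ∸ 1) s ++ head (label w) ∷ []) (sym (take-all ‖ v ‖ (ℓ G v) ≤-refl))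
  spell-∷ʳ i v (u ∷ ws) w j≡ = begin
    drop (i ∸ 1) (ℓ G v) ++ spellTail G u (ws ∷ʳ w) 1
      ≡⟨ cong (drop (i ∸ 1) (ℓ G v) ++_) (spellTail-∷ʳ u ws w (trans j≡ (cong ‖_‖ (last-∷ v u ws)))) ⟩
    drop (i ∸ 1) (ℓ G v) ++ (spellTail G u ws _ ++ head (label w) ∷ [])
      ≡⟨ sym (++-assoc (drop (i ∸ 1) (ℓ G v)) _ _) ⟩
    (drop (i ∸ 1) (ℓ G v) ++ spellTail G u ws _) ++ head (label w) ∷ [] ∎

  spell-cons : ∀ {i} v ws {j c} → (ws ≡ [] → i < j) → at (ℓ G v) (suc i) ≡ just c
             → spell G (suc i) (v ∷ ws) j ≡ c ∷ spell G (suc (suc i)) (v ∷ ws) j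
  spell-cons v []       i<j eq = drop-take-cons (ℓ G v) eq (i<j refl)
  spell-cons {i} v (w ∷ ws) {j} _ eq = cong (_++ spellTail G w ws j) (drop-cons {k = i} (ℓ G v) eq)

  spell-∷ : ∀ u v ws j → spell G ‖ u ‖ (u ∷ v ∷ ws) j ≡ last (label u) ∷ spell G 1 (v ∷ ws) j
  spell-∷ u v []      j = cong (_++ _) (drop-length-last (head (label u)) (tail (label u)))
  spell-∷ u v (_ ∷ _) j = cong (_++ _) (drop-length-last (head (label u)) (tail (label u)))

  -- The position in Q facing the last character of ℓ(v) when Q[x] faces ℓ(v)[i].
  pieceEnd : ℕ → ℕ → Fin n → ℕ
  pieceEnd x i v = x + (‖ v ‖ ∸ i)

  pieceEnd-shift : ∀ x v {i} → i < ‖ v ‖ → pieceEnd x i v ≡ pieceEnd (suc x) (suc i) v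
  pieceEnd-shift x v i<v = trans (cong (x +_) (∸-suc i<v)) (+-suc x _)

  pieceEnd-whole : ∀ x v → pieceEnd x ‖ v ‖ v ≡ x
  pieceEnd-whole x v = trans (cong (x +_) (n∸n≡0 ‖ v ‖)) (+-identityʳ x)

  nodeSuffixMatch : ℕ → ℕ → Fin n → Match G
  nodeSuffixMatch x i v = mkMatch x (pieceEnd x i v) i (v ∷ []) ‖ v ‖

  nodeMatchesFrom : ℕ → ℕ → ℕ → Fin n → List (Fin n) → ℕ → List (Match G)
  nodeMatchesFrom x y i v []       j = mkMatch x y i (v ∷ []) j ∷ []
  nodeMatchesFrom x y i v (w ∷ ws) j =
    nodeSuffixMatch x i v ∷ nodeMatchesFrom (suc (pieceEnd x i v)) y 1 w ws j

  nodeMatches : Match G → List (Match G)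
  nodeMatches (mkMatch x y i (v ∷ ws) j) = nodeMatchesFrom x y i v ws j

  length-nodeMatchesFrom : ∀ x y i v ws j → length (nodeMatchesFrom x y i v ws j) ≡ suc (length ws)
  length-nodeMatchesFrom x y i v []       j = refl
  length-nodeMatchesFrom x y i v (w ∷ ws) j = cong suc (length-nodeMatchesFrom _ y 1 w ws j)

  length-nodeMatches : ∀ m → length (nodeMatches m) ≡ pathLength G m
  length-nodeMatches (mkMatch x y i (v ∷ ws) j) = length-nodeMatchesFrom x y i v ws j

  length-concatMap-nodeMatches : ∀ ms → length (concatMap nodeMatches ms) ≡ sum (map (pathLength G) ms)
  length-concatMap-nodeMatches []       = refl
  length-concatMap-nodeMatches (m ∷ ms) =
    trans (length-++ (nodeMatches m)) (cong₂ _+_ (length-nodeMatches m) (length-concatMap-nodeMatches ms))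

  Edge? : ∀ u w → Dec (Edge G u w)
  Edge? u w = (u , w) ∈? E
    where open DecMembership (Product.≡-dec Fin._≟_ Fin._≟_) using (_∈?_)

  module _ (Q : List⁺ (Fin σ)) where

    inLeftExt? : ∀ m c → Dec (InLeftExt G Q m c)
    inLeftExt? (mkMatch x y i (v ∷ ws) j) c =
      (1 <? i ×-dec Maybe.≡-dec Fin._≟_ (at (ℓ G v) (i ∸ 1)) (just c))
      ⊎-dec (i ℕ.≟ 1 ×-dec Fin.any? λ u → Edge? u v ×-dec (last (label u) Fin.≟ c))

    inRightExt? : ∀ m c → Dec (InRightExt G Q m c)
    inRightExt? (mkMatch x y i P j) c =
      (j <? ‖ last P ‖ ×-dec Maybe.≡-dec Fin._≟_ (at (ℓ G (last P)) (j + 1)) (just c))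
      ⊎-dec (j ℕ.≟ ‖ last P ‖ ×-dec Fin.any? λ w → Edge? (last P) w ×-dec (head (label w) Fin.≟ c))

    singleNode-length : ∀ {x y i v j} → IsMatch G Q (mkMatch x y i (v ∷ []) j) → y ∸ (x ∸ 1) ≡ j ∸ (i ∸ 1)
    singleNode-length {x} {y} {i} {v} {j} ((_ , _ , y≤Q) , _ , _ , (_ , j≤v) , eq) = begin
      y ∸ (x ∸ 1)                    ≡⟨ sym (length-drop-take (x ∸ 1) (toList Q) y≤Q) ⟩
      length (substr (toList Q) x y) ≡⟨ cong length eq ⟩
      length (substr (ℓ G v) i j)    ≡⟨ length-drop-take (i ∸ 1) (ℓ G v) j≤v ⟩
      j ∸ (i ∸ 1)                    ∎

    singleNode-i∸1<j : ∀ {x y i v ws j} → IsMatch G Q (mkMatch x y i (v ∷ ws) j) → ws ≡ [] → i ∸ 1 < j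
    singleNode-i∸1<j {suc x} im@((_ , x<y , _) , _) refl =
      m∸n≢0⇒n<m (≢-sym (<⇒≢ (subst (0 <_) (singleNode-length im) (m<n⇒0<n∸m x<y))))

    singleNode-end : ∀ {x y i v} → IsMatch G Q (mkMatch x y i (v ∷ []) ‖ v ‖) → y ≡ pieceEnd x i v
    singleNode-end {suc x} {y} {suc i} {v} im@((_ , x<y , _) , _ , (_ , i<v) , _) = begin
      y                          ≡⟨ sym (m+[n∸m]≡n (<⇒≤ x<y)) ⟩
      x + (y ∸ x)                ≡⟨ cong (x +_) (singleNode-length im) ⟩
      pieceEnd x i v             ≡⟨ pieceEnd-shift x v i<v ⟩
      pieceEnd (suc x) (suc i) v ∎

    extensible⇒¬LeftMax : ∀ {x y i P j c} → at (toList Q) (suc x) ≡ just c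
      → InLeftExt G Q (mkMatch (suc (suc x)) y i P j) c → ¬ LeftMax G Q (mkMatch (suc (suc x)) y i P j)
    extensible⇒¬LeftMax _   _   (inj₁ ())
    extensible⇒¬LeftMax _   ext (inj₂ (inj₁ noExt))           = noExt _ ext
    extensible⇒¬LeftMax atQ ext (inj₂ (inj₂ (_ , atQ′ , ¬ext))) with just-injective (trans (sym atQ) atQ′)
    ... | refl = ¬ext ext

    extensible⇒¬RightMax : ∀ {x y i P j c} → y < length (toList Q) → at (toList Q) (y + 1) ≡ just c
      → InRightExt G Q (mkMatch x y i P j) c → ¬ RightMax G Q (mkMatch x y i P j)
    extensible⇒¬RightMax y<Q _   _   (inj₁ refl)                   = <-irrefl refl y<Q
    extensible⇒¬RightMax _   _   ext (inj₂ (inj₁ noExt))           = noExt _ ext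
    extensible⇒¬RightMax _   atQ ext (inj₂ (inj₂ (_ , atQ′ , ¬ext))) with just-injective (trans (sym atQ) atQ′)
    ... | refl = ¬ext ext

    isMatch-leftChar : ∀ {x y i v ws j c} → IsMatch G Q (mkMatch (suc (suc x)) y (suc (suc i)) (v ∷ ws) j)
      → at (toList Q) (suc x) ≡ just c → at (ℓ G v) (suc i) ≡ just c
      → IsMatch G Q (mkMatch (suc x) y (suc i) (v ∷ ws) j)
    isMatch-leftChar {x} {y} {i} {v} {ws} {j} {c} im@((_ , x<y , y≤Q) , isPath , (_ , i<v) , j∈v , eq) atQ atv =
      (s≤s z≤n , <⇒≤ x<y , y≤Q) , isPath , (s≤s z≤n , <⇒≤ i<v) , j∈v , (begin
        substr (toList Q) (suc x) y           ≡⟨ drop-take-cons (toList Q) atQ (<⇒≤ x<y) ⟩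
        c ∷ substr (toList Q) (suc (suc x)) y ≡⟨ cong (c ∷_) eq ⟩
        c ∷ spell G (suc (suc i)) (v ∷ ws) j  ≡⟨ sym (spell-cons v ws (<⇒≤ ∘ singleNode-i∸1<j im) atv) ⟩
        spell G (suc i) (v ∷ ws) j            ∎)

    isMatch-leftNode : ∀ {x y v ws j u c} → IsMatch G Q (mkMatch (suc (suc x)) y 1 (v ∷ ws) j)
      → at (toList Q) (suc x) ≡ just c → Edge G u v → last (label u) ≡ c
      → IsMatch G Q (mkMatch (suc x) y ‖ u ‖ (u ∷ v ∷ ws) j)
    isMatch-leftNode {x} {y} {v} {ws} {j} {u} ((_ , x<y , y≤Q) , isPath , _ , (1≤j , j≤v) , eq) atQ e refl =
      (s≤s z≤n , <⇒≤ x<y , y≤Q) , (e , isPath) , (s≤s z≤n , ≤-refl) ,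
      (1≤j , subst (j ≤_) (cong ‖_‖ (sym (last-∷ u v ws))) j≤v) , (begin
        substr (toList Q) (suc x) y                        ≡⟨ drop-take-cons (toList Q) atQ (<⇒≤ x<y) ⟩
        last (label u) ∷ substr (toList Q) (suc (suc x)) y ≡⟨ cong (last (label u) ∷_) eq ⟩
        last (label u) ∷ spell G 1 (v ∷ ws) j              ≡⟨ sym (spell-∷ u v ws j) ⟩
        spell G ‖ u ‖ (u ∷ v ∷ ws) j                       ∎)

    isMatch-rightChar : ∀ {x y i v ws j c} → IsMatch G Q (mkMatch x y i (v ∷ ws) j)
      → y < length (toList Q) → at (toList Q) (suc y) ≡ just c
      → j < ‖ last (v ∷ ws) ‖ → at (ℓ G (last (v ∷ ws))) (suc j) ≡ just c
      → IsMatch G Q (mkMatch x (suc y) i (v ∷ ws) (suc j))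
    isMatch-rightChar {x} {y} {i} {v} {ws} {j} {c} im@((1≤x , x≤y , _) , isPath , i∈v , _ , eq) y<Q atQ j<v atv =
      (1≤x , m≤n⇒m≤1+n x≤y , y<Q) , isPath , i∈v , (s≤s z≤n , j<v) , (begin
        substr (toList Q) x (suc y)     ≡⟨ drop-take-suc (toList Q) atQ (≤-trans (m∸n≤m x 1) x≤y) ⟩
        substr (toList Q) x y ++ c ∷ [] ≡⟨ cong (_++ c ∷ []) eq ⟩
        spell G i (v ∷ ws) j ++ c ∷ []  ≡⟨ sym (spell-suc v ws (singleNode-i∸1<j im) atv) ⟩
        spell G i (v ∷ ws) (suc j)      ∎)

    isMatch-rightNode : ∀ {x y i v ws j w c} → IsMatch G Q (mkMatch x y i (v ∷ ws) j)
      → y < length (toList Q) → at (toList Q) (suc y) ≡ just c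
      → j ≡ ‖ last (v ∷ ws) ‖ → Edge G (last (v ∷ ws)) w → head (label w) ≡ c
      → IsMatch G Q (mkMatch x (suc y) i (v ∷ (ws ∷ʳ w)) 1)
    isMatch-rightNode {x} {y} {i} {v} {ws} {j} {w} ((1≤x , x≤y , _) , isPath , i∈v , _ , eq) y<Q atQ j≡ e refl =
      (1≤x , m≤n⇒m≤1+n x≤y , y<Q) , IsPathL-∷ʳ v ws isPath e , i∈v ,
      (≤-refl , subst (λ z → 1 ≤ ‖ z ‖) (sym (last-∷ʳ v ws w)) (s≤s z≤n)) , (begin
        substr (toList Q) x (suc y)                  ≡⟨ drop-take-suc (toList Q) atQ (≤-trans (m∸n≤m x 1) x≤y) ⟩
        substr (toList Q) x y ++ head (label w) ∷ [] ≡⟨ cong (_++ head (label w) ∷ []) eq ⟩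
        spell G i (v ∷ ws) j ++ head (label w) ∷ []  ≡⟨ sym (spell-∷ʳ i v ws w j≡) ⟩
        spell G i (v ∷ (ws ∷ʳ w)) 1                  ∎)

    data LeftStep : Match G → Set where
      maximal : ∀ {m} → LeftMax G Q m → LeftStep m
      byChar  : ∀ {x y i P j} → ¬ LeftMax G Q (mkMatch (suc x) y (suc (suc i)) P j)
              → IsMatch G Q (mkMatch x y (suc i) P j) → LeftStep (mkMatch (suc x) y (suc (suc i)) P j)
      byNode  : ∀ {x y u P j} → IsMatch G Q (mkMatch x y ‖ u ‖ (u ∷⁺ P) j)
              → LeftStep (mkMatch (suc x) y 1 P j)

    leftStep : ∀ {x y i v ws j} → IsMatch G Q (mkMatch x y i (v ∷ ws) j) → LeftStep (mkMatch x y i (v ∷ ws) j)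
    leftStep {suc zero} _ = maximal (inj₁ refl)
    leftStep {suc (suc x)} {y} {i} {v} {ws} {j} im@((_ , x<y , y≤Q) , _)
      with at-< (toList Q) (≤-trans (n≤1+n _) (≤-trans x<y y≤Q))
    ... | c , atQ with inLeftExt? (mkMatch (suc (suc x)) y i (v ∷ ws) j) c
    ... | no ¬ext = maximal (inj₂ (inj₂ (c , atQ , ¬ext)))
    ... | yes ext@(inj₁ (s≤s (s≤s _) , atv)) =
      byChar {P = v ∷ ws} (extensible⇒¬LeftMax {y = y} {P = v ∷ ws} {j} atQ ext) (isMatch-leftChar im atQ atv)
    ... | yes (inj₂ (refl , u , e , lastu)) = byNode (isMatch-leftNode im atQ e lastu)

    data RightStep : Match G → Set where
      maximal : ∀ {m} → RightMax G Q m → RightStep m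
      byChar  : ∀ {x y i P j} → ¬ RightMax G Q (mkMatch x y i P j) → j < ‖ last P ‖
              → IsMatch G Q (mkMatch x (suc y) i P (suc j)) → RightStep (mkMatch x y i P j)
      byNode  : ∀ {x y i P j w} → j ≡ ‖ last P ‖
              → IsMatch G Q (mkMatch x (suc y) i (P ⁺∷ʳ w) 1) → RightStep (mkMatch x y i P j)

    rightStep : ∀ {x y i v ws j} → IsMatch G Q (mkMatch x y i (v ∷ ws) j) → RightStep (mkMatch x y i (v ∷ ws) j)
    rightStep {x} {y} {i} {v} {ws} {j} im@((_ , _ , y≤Q) , _) with m≤n⇒m<n∨m≡n y≤Q
    ... | inj₂ y≡Q = maximal (inj₁ y≡Q)
    ... | inj₁ y<Q with at-< (toList Q) y<Q
    ... | c , atQ with trans (at-+1 (toList Q) y) atQ | inRightExt? (mkMatch x y i (v ∷ ws) j) c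
    ... | atQ+1 | no ¬ext = maximal (inj₂ (inj₂ (c , atQ+1 , ¬ext)))
    ... | atQ+1 | yes ext@(inj₁ (j<v , atv)) =
      byChar {P = v ∷ ws} (extensible⇒¬RightMax {x} {y} {i} {v ∷ ws} {j} y<Q atQ+1 ext) j<v
             (isMatch-rightChar im y<Q atQ j<v (trans (sym (at-+1 (ℓ G (last (v ∷ ws))) j)) atv))
    ... | _ | yes (inj₂ (j≡v , w , e , headw)) =
      byNode {P = v ∷ ws} j≡v (isMatch-rightNode im y<Q atQ j≡v e headw)

    extendRight : ∀ k {x y i v w ws j} → length (toList Q) ≤ y + k → IsMatch G Q (mkMatch x y i (v ∷ w ∷ ws) j)
      → ∃[ m ] (IsMatch G Q m × RightMax G Q m × nodeSuffixMatch x i v ∈ nodeMatches m)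
    extendRight zero {y = y} Q≤y im@((_ , _ , y≤Q) , _) =
      _ , im , inj₁ (≤-antisym y≤Q (subst (_ ≤_) (+-identityʳ y) Q≤y)) , here refl
    extendRight (suc k) {y = y} Q≤y+k im with rightStep im
    ... | maximal rm     = _ , im , rm , here refl
    ... | byChar _ _ im′ = extendRight k (subst (length (toList Q) ≤_) (+-suc y k) Q≤y+k) im′
    ... | byNode _ im′   = extendRight k (subst (length (toList Q) ≤_) (+-suc y k) Q≤y+k) im′

    rightMaximalCover : ∀ {x y i v j} → IsMatch G Q (mkMatch x y i (v ∷ []) j)
      → RightMax G Q (mkMatch x y i (v ∷ []) j) ⊎ j ≡ ‖ v ‖
      → ∃[ m ] (IsMatch G Q m × RightMax G Q m × mkMatch x y i (v ∷ []) j ∈ nodeMatches m)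
    rightMaximalCover im _ with rightStep im
    rightMaximalCover im _    | maximal rm       = _ , im , rm , here refl
    rightMaximalCover im rmax | byChar ¬rm j<v _ = ⊥-elim ([ ¬rm , (λ j≡v → <-irrefl j≡v j<v) ]′ rmax)
    rightMaximalCover {x} {y} {i} {v} im _ | byNode refl im′
      with extendRight (length (toList Q)) (m≤n+m (length (toList Q)) (suc y)) im′
    ... | m , imm , rm , suffix∈m = m , imm , rm , subst (_∈ nodeMatches m) suffix≡ suffix∈m
      where
      suffix≡ : nodeSuffixMatch x i v ≡ mkMatch x y i (v ∷ []) ‖ v ‖
      suffix≡ = cong (λ y′ → mkMatch x y′ i (v ∷ []) ‖ v ‖) (sym (singleNode-end im))

    nodeMatches-leftShift : ∀ {x y i v ws j a} → suc i < ‖ v ‖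
      → ¬ LeftMax G Q (mkMatch (suc x) y (suc (suc i)) (v ∷ ws) j) → LeftMax G Q a ⊎ Match.i a ≡ 1
      → a ∈ nodeMatches (mkMatch (suc x) y (suc (suc i)) (v ∷ ws) j)
      → a ∈ nodeMatches (mkMatch x y (suc i) (v ∷ ws) j)
    -- The first piece shares x, i and its node with the whole match, hence also LeftMax; so a
    -- node MEM can be the first piece only of a match that no character step extends.
    nodeMatches-leftShift {ws = []}    _ ¬lm lmax (here refl) = ⊥-elim ([ ¬lm , (λ ()) ]′ lmax)
    nodeMatches-leftShift {ws = _ ∷ _} _ ¬lm lmax (here refl) = ⊥-elim ([ ¬lm , (λ ()) ]′ lmax)
    nodeMatches-leftShift {x} {y} {i} {v} {w ∷ ws} {j} {a} i<v _ _ (there a∈) =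
      there (subst (λ e → a ∈ nodeMatchesFrom (suc e) y 1 w ws j) (sym (pieceEnd-shift x v i<v)) a∈)

    nodeMatches-∷ : ∀ {x y v ws j u a} → a ∈ nodeMatches (mkMatch (suc x) y 1 (v ∷ ws) j)
      → a ∈ nodeMatches (mkMatch x y ‖ u ‖ (u ∷ v ∷ ws) j)
    nodeMatches-∷ {x} {y} {v} {ws} {j} {u} {a} a∈ =
      there (subst (λ e → a ∈ nodeMatchesFrom e y 1 v ws j) (sym (cong suc (pieceEnd-whole x u))) a∈)

    extendLeft : ∀ x {y i v ws j a}
      → IsMatch G Q (mkMatch x y i (v ∷ ws) j) → RightMax G Q (mkMatch x y i (v ∷ ws) j)
      → a ∈ nodeMatches (mkMatch x y i (v ∷ ws) j) → LeftMax G Q a ⊎ Match.i a ≡ 1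
      → ∃[ m ] (IsMEM G Q m × a ∈ nodeMatches m)
    extendLeft x im rm a∈ lmax with leftStep im
    ... | maximal lm = _ , (im , inj₁ lm , inj₁ rm) , a∈
    extendLeft (suc x) im@(_ , _ , (_ , i<v) , _) rm a∈ lmax | byChar ¬lm im′ =
      extendLeft x im′ rm (nodeMatches-leftShift i<v ¬lm lmax a∈) lmax
    extendLeft (suc x) {y} {v = v} {ws} {j} im rm a∈ lmax | byNode {u = u} im′ =
      extendLeft x im′ rm′ (nodeMatches-∷ a∈) lmax
      where
      -- RightMax reads the path only through its last node, and last (w ∷ []) reduces to w.
      rm′ : RightMax G Q (mkMatch x y ‖ u ‖ (u ∷ v ∷ ws) j)
      rm′ = subst (λ w → RightMax G Q (mkMatch x y ‖ u ‖ (w ∷ []) j)) (sym (last-∷ u v ws)) rm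

    nodeMEM⇒withinMEM : ∀ a → IsNodeMEM G Q a → ∃[ m ] (IsMEM G Q m × a ∈ nodeMatches m)
    nodeMEM⇒withinMEM (mkMatch x y i (v ∷ []) j) (im , refl , lmax , rmax) with rightMaximalCover im rmax
    ... | mkMatch x′ _ _ (_ ∷ _) _ , im′ , rm′ , a∈ = extendLeft x′ im′ rm′ a∈ lmax

corollary1 : ∀ {σ : ℕ} (G : LabeledGraph σ) → IsDAG G → (Q : List⁺ (Fin σ))
    → (A M : List (Match G))
    → Enumerates (IsNodeMEM G Q) A → Enumerates (IsMEM G Q) M
    → length A ≤ sum (map (pathLength G) M)
corollary1 G _ Q A M (uniqueA , enumA) (_ , enumM) = begin
  length A                              ≤⟨ Unique-⊆⇒length≤ uniqueA A⊆nodeMatchesM ⟩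
  length (concatMap (nodeMatches G) M)  ≡⟨ length-concatMap-nodeMatches G M ⟩
  sum (map (pathLength G) M)            ∎
  where
  open ≤-Reasoning
  A⊆nodeMatchesM : ∀ {a} → a ∈ A → a ∈ concatMap (nodeMatches G) M
  A⊆nodeMatchesM {a} a∈A with nodeMEM⇒withinMEM G Q a (Equivalence.to (enumA a) a∈A)
  ... | m , isMEM , a∈m = ∈-concat⁺′ a∈m (∈-map⁺ (nodeMatches G) (Equivalence.from (enumM m) isMEM))
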